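{- Let $a,b$ be integers with $b>a\geq 2$. Then $$I_{a,b} \geq P_a(a+b-1)\cdot P_b(a+b-1).$$
   Context: $K_{a,b}$ denotes the complete bipartite graph with partite sets of sizes $a$ and $b$. $I_{a,b}$ denotes the number of isomorphism classes (under graph isomorphism) of spanning trees of $K_{a,b}$. For positive integers $k,m$, $P_k(m)$ denotes the number of integer partitions of $m$ into exactly $k$ (positive) parts. -}

module Defs where

open import Data.Nat using (ℕ; zero; suc; _+_; _≤_; _≥_; _≤?_; _≥?_)
open import Data.Nat.Properties using (_≟_)
open import Data.Fin using (Fin)
open import Data.Bool using (Bool; true)
open import Data.Sum using (_⊎_; inj₁; inj₂)
open import Data.Product using (Σ; _×_; _,_)
open import Data.Empty using (⊥)
open import Data.List using (List; []; _∷_; _++_; [_]; length; filter; concatMap; map; upTo)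
open import Data.List.Relation.Unary.Unique.Propositional using (Unique)
open import Data.List.Relation.Unary.Linked using (Linked)
open import Data.Vec using (Vec; []; _∷_; sum)
open import Data.Vec.Relation.Unary.All as VAll using ()
open import Relation.Nullary using (Dec; yes; no; _×-dec_)
open import Relation.Unary using (Decidable)
open import Relation.Binary.PropositionalEquality using (_≡_)
open import Relation.Binary.Construct.Closure.ReflexiveTransitive using (Star)
open import Function.Bundles using (Inverse; _⇔_)

data NonIncreasing : {k : ℕ} → Vec ℕ k → Set where
  ni-[]  : NonIncreasing []
  ni-[x] : ∀ {x} → NonIncreasing (x ∷ [])
  ni-∷   : ∀ {k x y} {ys : Vec ℕ k} → y ≤ x → NonIncreasing (y ∷ ys) → NonIncreasing (x ∷ y ∷ ys)

nonIncreasing? : ∀ {k} (v : Vec ℕ k) → Dec (NonIncreasing v)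
nonIncreasing? [] = yes ni-[]
nonIncreasing? (x ∷ []) = yes ni-[x]
nonIncreasing? (x ∷ y ∷ ys) with y ≤? x | nonIncreasing? (y ∷ ys)
... | yes p | yes q = yes (ni-∷ p q)
... | no ¬p | _     = no λ { (ni-∷ p _) → ¬p p }
... | yes _ | no ¬q = no λ { (ni-∷ _ q) → ¬q q }

IsPartition : (k m : ℕ) → Vec ℕ k → Set
IsPartition k m v = VAll.All (λ x → x ≥ 1) v × NonIncreasing v × sum v ≡ m

isPartition? : (k m : ℕ) → Decidable (IsPartition k m)
isPartition? k m v = VAll.all? (λ x → x ≥? 1) v ×-dec (nonIncreasing? v ×-dec (sum v ≟ m))

vecsUpTo : (k m : ℕ) → List (Vec ℕ k)
vecsUpTo zero    m = [] ∷ []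
vecsUpTo (suc k) m = concatMap (λ x → map (x ∷_) (vecsUpTo k m)) (upTo (suc m))

-- P k m : the number of integer partitions of m into exactly k positive parts
-- (every part of such a partition is ≤ m, so the enumeration is exhaustive).
P : ℕ → ℕ → ℕ
P k m = length (filter (isPartition? k m) (vecsUpTo k m))

V : ℕ → ℕ → Set
V a b = Fin a ⊎ Fin b

-- A spanning subgraph of K_{a,b} is given by its edge set:
-- E i j = true iff the edge {inj₁ i, inj₂ j} is present.
EdgeSet : ℕ → ℕ → Set
EdgeSet a b = Fin a → Fin b → Bool

Adj : ∀ {a b} → EdgeSet a b → V a b → V a b → Set
Adj E (inj₁ i) (inj₁ i') = ⊥
Adj E (inj₁ i) (inj₂ j)  = E i j ≡ true
Adj E (inj₂ j) (inj₁ i)  = E i j ≡ true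
Adj E (inj₂ j) (inj₂ j') = ⊥

Connected : ∀ {a b} → EdgeSet a b → Set
Connected {a} {b} E = (u v : V a b) → Star (Adj E) u v

-- A cycle: distinct vertices v₀ v₁ … v_{r} (r ≥ 2, i.e. at least 3 vertices)
-- with v₀v₁, v₁v₂, …, v_{r-1}v_r and v_r v₀ all edges.
HasCycle : ∀ {a b} → EdgeSet a b → Set
HasCycle {a} {b} E =
  Σ (V a b) λ v → Σ (List (V a b)) λ rest →
    2 ≤ length rest × Unique (v ∷ rest) × Linked (Adj E) (v ∷ rest ++ [ v ])

Acyclic : ∀ {a b} → EdgeSet a b → Set
Acyclic E = HasCycle E → ⊥

IsTree : ∀ {a b} → EdgeSet a b → Set
IsTree E = Connected E × Acyclic E

SpanningTree : ℕ → ℕ → Set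
SpanningTree a b = Σ (EdgeSet a b) IsTree

-- It need not respect the bipartition.
Isomorphic : ∀ {a b} → EdgeSet a b → EdgeSet a b → Set
Isomorphic {a} {b} E F =
  Σ (Inverse (≡-setoid) (≡-setoid)) λ σ →
    (u v : V a b) → Adj E u v ⇔ Adj F (Inverse.to σ u) (Inverse.to σ v)
  where open import Relation.Binary.PropositionalEquality using () renaming (setoid to ≡-setoid')
        ≡-setoid = ≡-setoid' (V a b)

-- The degrees of a spanning tree of K_{a,b} on the two sides are partitions
-- of its a + b − 1 edges into a and into b positive parts. Conversely, every
-- such pair of partitions (λ, μ) is realised by a tree: root it at the
-- vertex B_0 of the larger side, give it μ_0 children, each further B_j
-- μ_j − 1 children and each A_i λ_i − 1 children, handing out children in
-- order. Because λ and μ are nonincreasing, the A-vertex that B_j is handed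
-- to already hangs below one of B_0, …, B_(j−1), so this really is a tree
-- (rank the vertices by when they are attached). Since a < b, a graph
-- isomorphism between two such trees must preserve the sides, hence the
-- multisets of degrees on each side; so different pairs of partitions give
-- non-isomorphic trees.

module Submission where

open import Defs
open import Data.Bool using (Bool; true; false; not; _∨_; _xor_)
open import Data.Empty using (⊥; ⊥-elim)
open import Data.Fin using (Fin; zero; suc; toℕ; fromℕ<; remQuot; combine)
open import Data.Fin.Permutation using (Permutation; _⟨$⟩ʳ_)
open import Data.Fin.Properties using (toℕ<n; toℕ-injective; toℕ-fromℕ<; injective⇒≤; combine-remQuot)
open import Data.List as List using (List; []; _∷_; _++_; [_]; length; filter; upTo; concatMap; cartesianProductWith)
open import Data.List.Membership.Propositional using (_∈_)
open import Data.List.Membership.Propositional.Properties using (∈-lookup)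
open import Data.List.Relation.Unary.All as All using ([]; _∷_)
open import Data.List.Relation.Unary.All.Properties using (all-filter)
open import Data.List.Relation.Unary.Any using (here; there)
open import Data.List.Relation.Unary.Linked using (Linked; []; [-]; _∷_)
open import Data.List.Relation.Unary.Unique.Propositional using (Unique; []; _∷_)
import Data.List.Relation.Unary.Unique.Propositional.Properties as Unique
open import Data.Nat
open import Data.Nat.Induction using (<-wellFounded)
open import Data.Nat.Properties
open import Data.Product using (Σ; Σ-syntax; ∃-syntax; _×_; _,_; proj₁; proj₂; map₂; uncurry)
open import Data.Product.Properties using (×-≡,≡→≡)
open import Data.Sum using (_⊎_; inj₁; inj₂; swap)
open import Data.Sum.Properties using (inj₁-injective; inj₂-injective)
open import Data.Unit using (⊤; tt)
open import Data.Vec using (Vec; []; _∷_; lookup; sum; map; tabulate)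
open import Data.Vec.Properties using (tabulate∘lookup; tabulate-cong; lookup-map; ∷-injective)
open import Data.Vec.Relation.Unary.All as VAll using ([]; _∷_)
open import Data.Vec.Relation.Unary.All.Properties using (lookup⁺)
open import Function using (_∘_; _on_; _↔_; Inverse; mk↔ₛ′; _⇔_; Equivalence; Injection)
open import Function.Properties.Inverse using (↔⇒↣)
open import Induction.WellFounded using (Acc; acc)
open import Relation.Binary.Construct.Closure.ReflexiveTransitive using (Star; ε; _◅_; _◅◅_; reverse)
open import Relation.Binary.Construct.On using (wellFounded)
open import Relation.Binary.PropositionalEquality
  using (_≡_; _≢_; refl; sym; trans; cong; cong₂; subst; subst₂; module ≡-Reasoning)
open import Relation.Nullary using (Dec; yes; no; does)
open import Relation.Nullary.Decidable using (dec-true; dec-false)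
open import Algebra.Properties.CommutativeMonoid.Sum +-0-commutativeMonoid as FinSum using ()

fromBool : Bool → ℕ
fromBool true  = 1
fromBool false = 0

fromBool-∨ : ∀ x y → (x ≡ true → y ≡ true → ⊥) → fromBool (x ∨ y) ≡ fromBool x + fromBool y
fromBool-∨ true  true  disjoint = ⊥-elim (disjoint refl refl)
fromBool-∨ true  false _        = refl
fromBool-∨ false y     _        = refl

count : ∀ {n} → (Fin n → Bool) → ℕ
count f = FinSum.sum (λ i → fromBool (f i))

count-cong : ∀ {n} {f g : Fin n → Bool} → (∀ i → f i ≡ g i) → count f ≡ count g
count-cong f≗g = FinSum.sum-cong-≗ (λ i → cong fromBool (f≗g i))

count-false : ∀ n → count {n} (λ _ → false) ≡ 0
count-false zero    = refl
count-false (suc n) = count-false n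

count-∨ : ∀ {n} (f g : Fin n → Bool) → (∀ i → f i ≡ true → g i ≡ true → ⊥) →
          count (λ i → f i ∨ g i) ≡ count f + count g
count-∨ f g disjoint =
  trans (FinSum.sum-cong-≗ (λ i → fromBool-∨ (f i) (g i) (disjoint i)))
        (FinSum.∑-distrib-+ (λ i → fromBool (f i)) (λ i → fromBool (g i)))

count-reindex : ∀ {n} (f : Fin n → Bool) {g : Fin n → Bool} (π : Permutation n n) → (∀ i → f (π ⟨$⟩ʳ i) ≡ g i) →
                count f ≡ count g
count-reindex f π f∘π≗g = trans (FinSum.sum-permute _ π) (count-cong f∘π≗g)

countBelow : ℕ → (ℕ → Bool) → ℕ
countBelow n f = count {n} (λ j → f (toℕ j))

countBelow-≟ : ∀ {n c} → c < n → countBelow n (λ q → does (c ≟ q)) ≡ 1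
countBelow-≟ {suc n} {zero}  _         = cong suc (count-false n)
countBelow-≟ {suc n} {suc c} (s≤s c<n) = countBelow-≟ c<n

-- Cutting ℕ into consecutive blocks

-- The index of the block containing position p when ℕ is cut into
-- consecutive blocks of sizes cs; it is the length of cs once p ≥ sum cs.
block : ∀ {n} → Vec ℕ n → ℕ → ℕ
block []           p       = 0
block (zero  ∷ cs) p       = suc (block cs p)
block (suc c ∷ cs) zero    = 0
block (suc c ∷ cs) (suc p) = block (c ∷ cs) p

prefixSum : ∀ {n} → Vec ℕ n → ℕ → ℕ
prefixSum []       k       = 0
prefixSum (c ∷ cs) zero    = 0
prefixSum (c ∷ cs) (suc k) = c + prefixSum cs k

prefixSum-suc-head : ∀ {n} c (cs : Vec ℕ n) k → prefixSum (suc c ∷ cs) k ≤ suc (prefixSum (c ∷ cs) k)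
prefixSum-suc-head c cs zero    = z≤n
prefixSum-suc-head c cs (suc k) = ≤-refl

prefixSum-block≤ : ∀ {n} (cs : Vec ℕ n) p → prefixSum cs (block cs p) ≤ p
prefixSum-block≤ []           p       = z≤n
prefixSum-block≤ (zero  ∷ cs) p       = prefixSum-block≤ cs p
prefixSum-block≤ (suc c ∷ cs) zero    = z≤n
prefixSum-block≤ (suc c ∷ cs) (suc p) =
  ≤-trans (prefixSum-suc-head c cs (block (c ∷ cs) p)) (s≤s (prefixSum-block≤ (c ∷ cs) p))

block<-prefixSum : ∀ {n} (cs : Vec ℕ n) p k → p < prefixSum cs k → block cs p < k
block<-prefixSum (zero  ∷ cs) p       (suc k) p<  = s<s (block<-prefixSum cs p k p<)
block<-prefixSum (suc c ∷ cs) zero    (suc k) _   = z<s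
block<-prefixSum (suc c ∷ cs) (suc p) (suc k) p<  = block<-prefixSum (c ∷ cs) p (suc k) (s<s⁻¹ p<)

prefixSum-all : ∀ {n} (cs : Vec ℕ n) k → n ≤ k → prefixSum cs k ≡ sum cs
prefixSum-all []       k       _         = refl
prefixSum-all (c ∷ cs) (suc k) (s≤s n≤k) = cong (c +_) (prefixSum-all cs k n≤k)

block<length : ∀ {n} (cs : Vec ℕ n) p → p < sum cs → block cs p < n
block<length {n} cs p p<sum =
  block<-prefixSum cs p n (subst (p <_) (sym (prefixSum-all cs n ≤-refl)) p<sum)

countBelow-block : ∀ {n} (cs : Vec ℕ n) i →
                   countBelow (sum cs) (λ p → does (block cs p ≟ toℕ i)) ≡ lookup cs i
countBelow-block (zero  ∷ cs) zero    = count-false (sum cs)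
countBelow-block (zero  ∷ cs) (suc i) = countBelow-block cs i
countBelow-block (suc c ∷ cs) zero    = cong suc (countBelow-block (c ∷ cs) zero)
countBelow-block (suc c ∷ cs) (suc i) = countBelow-block (c ∷ cs) (suc i)

nonIncreasing-tail : ∀ {k x} {xs : Vec ℕ k} → NonIncreasing (x ∷ xs) → NonIncreasing xs
nonIncreasing-tail ni-[x]     = ni-[]
nonIncreasing-tail (ni-∷ _ r) = r

nonIncreasing-head : ∀ {k x} {xs : Vec ℕ k} → NonIncreasing (x ∷ xs) → ∀ i → lookup xs i ≤ x
nonIncreasing-head (ni-∷ y≤x _) zero    = y≤x
nonIncreasing-head (ni-∷ y≤x r) (suc i) = ≤-trans (nonIncreasing-head r i) y≤x

nonIncreasing-map : ∀ {k} {f : ℕ → ℕ} → (∀ {x y} → x ≤ y → f x ≤ f y) →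
                    {v : Vec ℕ k} → NonIncreasing v → NonIncreasing (map f v)
nonIncreasing-map f-mono ni-[]        = ni-[]
nonIncreasing-map f-mono ni-[x]       = ni-[x]
nonIncreasing-map f-mono (ni-∷ y≤x r) = ni-∷ (f-mono y≤x) (nonIncreasing-map f-mono r)

sum-zeros : ∀ {k} {xs : Vec ℕ k} → NonIncreasing (0 ∷ xs) → sum xs ≡ 0
sum-zeros {xs = []}    _            = refl
sum-zeros {xs = _ ∷ _} (ni-∷ z≤n r) = sum-zeros r

-- Either one of the first k parts is zero, and then so are all later ones,
-- or each of them contributes at least 1.
≤-prefixSum : ∀ {n} (cs : Vec ℕ n) k t → NonIncreasing cs → t ≤ k → t ≤ sum cs → t ≤ prefixSum cs k
≤-prefixSum cs           k       zero    _  _         _         = z≤n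
≤-prefixSum (zero  ∷ cs) (suc k) (suc t) ni _         t<sum     =
  ⊥-elim (1+n≢0 (n≤0⇒n≡0 (subst (suc t ≤_) (sum-zeros ni) t<sum)))
≤-prefixSum (suc c ∷ cs) (suc k) (suc t) ni (s≤s t≤k) (s≤s t≤sum) =
  s≤s (≤-trans (m≤n+m∸n t c) (+-monoʳ-≤ c (≤-prefixSum cs k (t ∸ c) (nonIncreasing-tail ni)
        (≤-trans (m∸n≤m t c) t≤k) (subst (t ∸ c ≤_) (m+n∸m≡n c (sum cs)) (∸-monoˡ-≤ c t≤sum)))))

atLeast : ∀ {n} → (Fin n → ℕ) → ℕ → ℕ
atLeast v t = count (λ i → does (t ≤? v i))

atLeast-cong : ∀ {n} {v w : Fin n → ℕ} → (∀ i → v i ≡ w i) → ∀ t → atLeast v t ≡ atLeast w t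
atLeast-cong v≗w t = count-cong (λ i → cong (λ x → does (t ≤? x)) (v≗w i))

atLeast-tail-≡0 : ∀ {k x t} {xs : Vec ℕ k} → NonIncreasing (x ∷ xs) → x < t → atLeast (lookup xs) t ≡ 0
atLeast-tail-≡0 {k} {t = t} {xs} ni x<t =
  trans (count-cong (λ i → dec-false (t ≤? lookup xs i) (<⇒≱ (≤-<-trans (nonIncreasing-head ni i) x<t))))
        (count-false k)

≤⇒<atLeast : ∀ {k} (v : Vec ℕ k) t i → NonIncreasing v → t ≤ lookup v i → toℕ i < atLeast (lookup v) t
≤⇒<atLeast (x ∷ xs) t zero    ni t≤x rewrite dec-true (t ≤? x) t≤x = z<s
≤⇒<atLeast (x ∷ xs) t (suc i) ni t≤xᵢ
  rewrite dec-true (t ≤? x) (≤-trans t≤xᵢ (nonIncreasing-head ni i)) =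
  s<s (≤⇒<atLeast xs t i (nonIncreasing-tail ni) t≤xᵢ)

<atLeast⇒≤ : ∀ {k} (v : Vec ℕ k) t i → NonIncreasing v → toℕ i < atLeast (lookup v) t → t ≤ lookup v i
<atLeast⇒≤ (x ∷ xs) t i ni i< with t ≤? x
<atLeast⇒≤ (x ∷ xs) t zero    ni _  | yes t≤x = t≤x
<atLeast⇒≤ (x ∷ xs) t (suc i) ni i< | yes t≤x rewrite dec-true (t ≤? x) t≤x =
  <atLeast⇒≤ xs t i (nonIncreasing-tail ni) (s<s⁻¹ i<)
<atLeast⇒≤ (x ∷ xs) t i       ni i< | no  t≰x rewrite dec-false (t ≤? x) t≰x =
  ⊥-elim (n≮0 (subst (toℕ i <_) (atLeast-tail-≡0 ni (≰⇒> t≰x)) i<))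

atLeast-injective : ∀ {k} (v w : Vec ℕ k) → NonIncreasing v → NonIncreasing w →
                    (∀ t → atLeast (lookup v) t ≡ atLeast (lookup w) t) → v ≡ w
atLeast-injective v w niv niw same = begin
  v                    ≡⟨ tabulate∘lookup v ⟨
  tabulate (lookup v)  ≡⟨ tabulate-cong (λ i → ≤-antisym (≤-lookup v w niv niw same i)
                                                           (≤-lookup w v niw niv (sym ∘ same) i)) ⟩
  tabulate (lookup w)  ≡⟨ tabulate∘lookup w ⟩
  w                    ∎
  where
  open ≡-Reasoning
  ≤-lookup : ∀ {k} (v w : Vec ℕ k) → NonIncreasing v → NonIncreasing w →
             (∀ t → atLeast (lookup v) t ≡ atLeast (lookup w) t) → ∀ i → lookup v i ≤ lookup w i
  ≤-lookup v w niv niw same i = <atLeast⇒≤ w (lookup v i) i niw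
    (subst (toℕ i <_) (same (lookup v i)) (≤⇒<atLeast v (lookup v i) i niv ≤-refl))

atLeast-reindex : ∀ {n} (v : Fin n → ℕ) {w : Fin n → ℕ} (π : Permutation n n) → (∀ i → v (π ⟨$⟩ʳ i) ≡ w i) →
                  ∀ t → atLeast v t ≡ atLeast w t
atLeast-reindex v π v∘π≗w t = count-reindex _ π (λ i → cong (λ x → does (t ≤? x)) (v∘π≗w i))

-- Forests given by a ranked parent relation

lastOf : ∀ {A : Set} → A → List A → A
lastOf x []       = x
lastOf x (y ∷ ys) = lastOf y ys

lastOf-∈ : ∀ {A : Set} (x : A) xs → lastOf x xs ∈ x ∷ xs
lastOf-∈ x []       = here refl
lastOf-∈ x (y ∷ ys) = there (lastOf-∈ y ys)

secondLast : ∀ {A : Set} → A → A → List A → A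
secondLast x y []       = x
secondLast x y (z ∷ zs) = secondLast y z zs

secondLast-∈ : ∀ {A : Set} (x y : A) zs → secondLast x y zs ∈ x ∷ y ∷ zs
secondLast-∈ x y []       = here refl
secondLast-∈ x y (z ∷ zs) = there (secondLast-∈ y z zs)

NonBacktracking : ∀ {A : Set} → List A → Set
NonBacktracking (x ∷ y ∷ z ∷ zs) = x ≢ z × NonBacktracking (y ∷ z ∷ zs)
NonBacktracking _                = ⊤

nonBacktracking-tail : ∀ {A : Set} (x : A) xs → NonBacktracking (x ∷ xs) → NonBacktracking xs
nonBacktracking-tail x []           _        = tt
nonBacktracking-tail x (y ∷ [])     _        = tt
nonBacktracking-tail x (y ∷ z ∷ zs) (_ , nb) = nb

nonBacktracking-∷ʳ : ∀ {A : Set} (x y : A) zs w → Unique (x ∷ y ∷ zs) → w ≢ secondLast x y zs →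
                     NonBacktracking (x ∷ y ∷ zs ++ [ w ])
nonBacktracking-∷ʳ x y []       w _                     w≢x = (λ x≡w → w≢x (sym x≡w)) , tt
nonBacktracking-∷ʳ x y (z ∷ zs) w ((_ ∷ x≢z ∷ _) ∷ uniq) w≢ = x≢z , nonBacktracking-∷ʳ y z zs w uniq w≢

-- u ↑ v says that v is the parent of u.
module RankedParents {V : Set} (R : V → V → Set) (_↑_ : V → V → Set) (rank : V → ℕ)
  (rank-↑ : ∀ {u v} → u ↑ v → rank v < rank u)
  (↑-functional : ∀ {u v w} → u ↑ v → u ↑ w → v ≡ w)
  (↑⇒R : ∀ {u v} → u ↑ v → R u v)
  (R⇒↑ : ∀ {u v} → R u v → u ↑ v ⊎ v ↑ u) where

  ↑-asym : ∀ {u v} → u ↑ v → v ↑ u → ⊥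
  ↑-asym u↑v v↑u = <-asym (rank-↑ u↑v) (rank-↑ v↑u)

  reachesRoot : (root : V) → (∀ u → u ≡ root ⊎ ∃[ w ] u ↑ w) → ∀ u → Star R u root
  reachesRoot root hasParent u = climb u (wellFounded rank <-wellFounded u)
    where
    climb : ∀ u → Acc (_<_ on rank) u → Star R u root
    climb u (acc smaller) with hasParent u
    ... | inj₁ refl      = ε
    ... | inj₂ (w , u↑w) = ↑⇒R u↑w ◅ climb w (smaller (rank-↑ u↑w))

  -- Stepping back up right after stepping down would return to the same
  -- vertex, because the parent is unique.
  once-down-always-down : ∀ x y ys w → y ↑ x → Linked R (x ∷ y ∷ ys ++ [ w ]) →
                          NonBacktracking (x ∷ y ∷ ys ++ [ w ]) → w ↑ lastOf y ys × rank x < rank w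
  once-down-always-down x y []       w y↑x (_ ∷ Ryw ∷ [-]) (x≢w , _) with R⇒↑ Ryw
  ... | inj₁ y↑w = ⊥-elim (x≢w (↑-functional y↑x y↑w))
  ... | inj₂ w↑y = w↑y , <-trans (rank-↑ y↑x) (rank-↑ w↑y)
  once-down-always-down x y (z ∷ zs) w y↑x (_ ∷ walk@(Ryz ∷ _)) (x≢z , nb) with R⇒↑ Ryz
  ... | inj₁ y↑z = ⊥-elim (x≢z (↑-functional y↑x y↑z))
  ... | inj₂ z↑y = map₂ (<-trans (rank-↑ y↑x)) (once-down-always-down y z zs w z↑y walk nb)

  rank-drops-or-ends-down : ∀ x ys w → Linked R (x ∷ ys ++ [ w ]) → NonBacktracking (x ∷ ys ++ [ w ]) →
                            rank w < rank x ⊎ w ↑ lastOf x ys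
  rank-drops-or-ends-down x []       w (Rxw ∷ [-]) _ with R⇒↑ Rxw
  ... | inj₁ x↑w = inj₁ (rank-↑ x↑w)
  ... | inj₂ w↑x = inj₂ w↑x
  rank-drops-or-ends-down x (y ∷ ys) w walk@(Rxy ∷ walk′) nb
    with rank-drops-or-ends-down y ys w walk′ (nonBacktracking-tail x _ nb)
  ... | inj₂ ends-down = inj₂ ends-down
  ... | inj₁ w<y with R⇒↑ Rxy
  ...   | inj₁ x↑y = inj₁ (<-trans w<y (rank-↑ x↑y))
  ...   | inj₂ y↑x = inj₂ (proj₁ (once-down-always-down x y ys w y↑x walk nb))

  -- A closed walk can neither only climb nor only descend, so it must both
  -- leave v and re-enter v through the parent of v, which then occurs twice.
  noCycle : ∀ v rest → 2 ≤ length rest → Unique (v ∷ rest) → Linked R (v ∷ rest ++ [ v ]) → ⊥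
  noCycle v (_ ∷ [])     (s≤s ())
  noCycle v (r ∷ s ∷ ss) _ uniq@(v∉rest ∷ r∉ss ∷ _) walk@(Rvr ∷ _) = impossible
    where
    nb : NonBacktracking (v ∷ r ∷ s ∷ ss ++ [ v ])
    nb = nonBacktracking-∷ʳ v r (s ∷ ss) v uniq (All.lookup v∉rest (secondLast-∈ r s ss))
    impossible : ⊥
    impossible with rank-drops-or-ends-down v (r ∷ s ∷ ss) v walk nb
    ... | inj₁ v<v = <-irrefl refl v<v
    ... | inj₂ v↑last with R⇒↑ Rvr
    ...   | inj₁ v↑r = All.lookup r∉ss (lastOf-∈ s ss) (↑-functional v↑r v↑last)
    ...   | inj₂ r↑v = <-irrefl refl (proj₂ (once-down-always-down v r (s ∷ ss) v r↑v walk nb))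

-- Isomorphisms of spanning subgraphs of K_{a,b}

module _ {X Y : Set} (σ : X ↔ X) (e : Y → X) (e-injective : ∀ {y y′} → e y ≡ e y′ → y ≡ y′)
         (to-e   : ∀ y → ∃[ y′ ] Inverse.to   σ (e y) ≡ e y′)
         (from-e : ∀ y → ∃[ y′ ] Inverse.from σ (e y) ≡ e y′) where

  open Inverse σ

  restrict : Y ↔ Y
  restrict = mk↔ₛ′ (proj₁ ∘ to-e) (proj₁ ∘ from-e) to∘from from∘to
    where
    open ≡-Reasoning
    to∘from : ∀ y → proj₁ (to-e (proj₁ (from-e y))) ≡ y
    to∘from y = e-injective (begin
      e (proj₁ (to-e (proj₁ (from-e y)))) ≡⟨ proj₂ (to-e _) ⟨
      to (e (proj₁ (from-e y)))            ≡⟨ cong to (proj₂ (from-e y)) ⟨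
      to (from (e y))                      ≡⟨ strictlyInverseˡ (e y) ⟩
      e y                                  ∎)
    from∘to : ∀ y → proj₁ (from-e (proj₁ (to-e y))) ≡ y
    from∘to y = e-injective (begin
      e (proj₁ (from-e (proj₁ (to-e y)))) ≡⟨ proj₂ (from-e _) ⟨
      from (e (proj₁ (to-e y)))            ≡⟨ cong from (proj₂ (to-e y)) ⟨
      from (to (e y))                      ≡⟨ strictlyInverseʳ (e y) ⟩
      e y                                  ∎)

  restrict-to : ∀ y → e (Inverse.to restrict y) ≡ to (e y)
  restrict-to y = sym (proj₂ (to-e y))

side : ∀ {a b} → V a b → Bool
side (inj₁ _) = true
side (inj₂ _) = false

side-true : ∀ {a b} (v : V a b) → side v ≡ true → ∃[ i ] v ≡ inj₁ i
side-true (inj₁ i) _ = i , refl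

side-false : ∀ {a b} (v : V a b) → side v ≡ false → ∃[ j ] v ≡ inj₂ j
side-false (inj₂ j) _ = j , refl

Adj-sym : ∀ {a b} {E : EdgeSet a b} {u v} → Adj E u v → Adj E v u
Adj-sym {u = inj₁ _} {inj₂ _} e = e
Adj-sym {u = inj₂ _} {inj₁ _} e = e

rooted⇒connected : ∀ {a b} {E : EdgeSet a b} root → (∀ u → Star (Adj E) u root) → Connected E
rooted⇒connected root reach u v = reach u ◅◅ reverse Adj-sym (reach v)

Adj-side : ∀ {a b} {E : EdgeSet a b} {u v} → Adj E u v → side v ≡ not (side u)
Adj-side {u = inj₁ _} {inj₂ _} _ = refl
Adj-side {u = inj₂ _} {inj₁ _} _ = refl

xor-not : ∀ x y → not x xor not y ≡ x xor y
xor-not true  y     = refl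
xor-not false true  = refl
xor-not false false = refl

xor≡false : ∀ {x y} → x xor y ≡ false → y ≡ x
xor≡false {true}  {true}  _ = refl
xor≡false {false} {false} _ = refl

≡true-⇔⇒≡ : ∀ {x y} → (x ≡ true ⇔ y ≡ true) → x ≡ y
≡true-⇔⇒≡ {true}  {true}  _   = refl
≡true-⇔⇒≡ {true}  {false} x⇔y = sym (Equivalence.to x⇔y refl)
≡true-⇔⇒≡ {false} {true}  x⇔y = Equivalence.from x⇔y refl
≡true-⇔⇒≡ {false} {false} _   = refl

deg₁ : ∀ {a b} → EdgeSet a b → Fin a → ℕ
deg₁ E i = count (E i)

deg₂ : ∀ {a b} → EdgeSet a b → Fin b → ℕ
deg₂ E j = count (λ i → E i j)

module _ {a b} {E F : EdgeSet a (suc b)} (a<b : a < suc b) (connected : Connected E)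
         (iso : Isomorphic E F) where

  private
    σ = proj₁ iso
    open Inverse σ

  swapped : V a (suc b) → Bool
  swapped u = side u xor side (to u)

  swapped-invariant : ∀ {u v} → Star (Adj E) u v → swapped u ≡ swapped v
  swapped-invariant ε = refl
  swapped-invariant {u} (_◅_ {j = w} e walk) = trans swapped-step (swapped-invariant walk)
    where
    swapped-step : swapped u ≡ swapped w
    swapped-step rewrite Adj-side e | Adj-side (Equivalence.to (proj₂ iso u w) e) =
      sym (xor-not (side u) (side (to u)))

  -- If σ swapped the sides, it would embed the larger side into the smaller one.
  to-preserves-side : ∀ u → side (to u) ≡ side u
  to-preserves-side u with swapped (inj₂ zero) in root-swapped
  ... | false = xor≡false (trans (swapped-invariant (connected u (inj₂ zero))) root-swapped)
  ... | true  = ⊥-elim (<⇒≱ a<b (injective⇒≤ {f = B→A} B→A-injective))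
    where
    lands-in-A : ∀ j → side (to (inj₂ j)) ≡ true
    lands-in-A j = trans (swapped-invariant (connected (inj₂ j) (inj₂ zero))) root-swapped
    B→A : Fin (suc b) → Fin a
    B→A j = proj₁ (side-true _ (lands-in-A j))
    B→A-injective : ∀ {j j′} → B→A j ≡ B→A j′ → j ≡ j′
    B→A-injective {j} {j′} eq = inj₂-injective (Injection.injective (↔⇒↣ σ) (begin
      to (inj₂ j)   ≡⟨ proj₂ (side-true _ (lands-in-A j)) ⟩
      inj₁ (B→A j)  ≡⟨ cong inj₁ eq ⟩
      inj₁ (B→A j′) ≡⟨ proj₂ (side-true _ (lands-in-A j′)) ⟨
      to (inj₂ j′)  ∎))
      where open ≡-Reasoning

  from-preserves-side : ∀ v → side (from v) ≡ side v
  from-preserves-side v = trans (sym (to-preserves-side (from v))) (cong side (strictlyInverseˡ v))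

  private
    to-inj₁ : ∀ i → ∃[ i′ ] to (inj₁ i) ≡ inj₁ i′
    to-inj₁ i = side-true _ (to-preserves-side (inj₁ i))
    from-inj₁ : ∀ i → ∃[ i′ ] from (inj₁ i) ≡ inj₁ i′
    from-inj₁ i = side-true _ (from-preserves-side (inj₁ i))
    to-inj₂ : ∀ j → ∃[ j′ ] to (inj₂ j) ≡ inj₂ j′
    to-inj₂ j = side-false _ (to-preserves-side (inj₂ j))
    from-inj₂ : ∀ j → ∃[ j′ ] from (inj₂ j) ≡ inj₂ j′
    from-inj₂ j = side-false _ (from-preserves-side (inj₂ j))

  π₁ : Permutation a a
  π₁ = restrict σ inj₁ inj₁-injective to-inj₁ from-inj₁

  π₂ : Permutation (suc b) (suc b)
  π₂ = restrict σ inj₂ inj₂-injective to-inj₂ from-inj₂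

  edge-permute : ∀ i j → F (π₁ ⟨$⟩ʳ i) (π₂ ⟨$⟩ʳ j) ≡ E i j
  edge-permute i j = sym (≡true-⇔⇒≡ (subst₂ (λ u v → Adj E (inj₁ i) (inj₂ j) ⇔ Adj F u v)
    (sym (restrict-to σ inj₁ inj₁-injective to-inj₁ from-inj₁ i))
    (sym (restrict-to σ inj₂ inj₂-injective to-inj₂ from-inj₂ j))
    (proj₂ iso (inj₁ i) (inj₂ j))))

  deg₁-reindex : ∀ i → deg₁ F (π₁ ⟨$⟩ʳ i) ≡ deg₁ E i
  deg₁-reindex i = count-reindex (F (π₁ ⟨$⟩ʳ i)) π₂ (edge-permute i)

  deg₂-reindex : ∀ j → deg₂ F (π₂ ⟨$⟩ʳ j) ≡ deg₂ E j
  deg₂-reindex j = count-reindex (λ i → F i (π₂ ⟨$⟩ʳ j)) π₁ (λ i → edge-permute i j)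

  atLeast-deg₁ : ∀ t → atLeast (deg₁ F) t ≡ atLeast (deg₁ E) t
  atLeast-deg₁ = atLeast-reindex (deg₁ F) π₁ deg₁-reindex

  atLeast-deg₂ : ∀ t → atLeast (deg₂ F) t ≡ atLeast (deg₂ E) t
  atLeast-deg₂ = atLeast-reindex (deg₂ F) π₂ deg₂-reindex

-- A spanning tree with prescribed degrees

record HasDegrees {a b} (E : EdgeSet a b) (d₁ : Vec ℕ a) (d₂ : Vec ℕ b) : Set where
  field
    deg₁-≡ : ∀ i → deg₁ E i ≡ lookup d₁ i
    deg₂-≡ : ∀ j → deg₂ E j ≡ lookup d₂ j

does-∨ : ∀ {P Q : Set} (p : Dec P) (q : Dec Q) → does p ∨ does q ≡ true → P ⊎ Q
does-∨ (yes p) _       _ = inj₁ p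
does-∨ (no _)  (yes q) _ = inj₂ q

does-∨ˡ : ∀ {P Q : Set} (p : Dec P) (q : Dec Q) → P → does p ∨ does q ≡ true
does-∨ˡ (yes _) _ _  = refl
does-∨ˡ (no ¬p) _ p′ = ⊥-elim (¬p p′)

does-∨ʳ : ∀ {P Q : Set} (p : Dec P) (q : Dec Q) → Q → does p ∨ does q ≡ true
does-∨ʳ (yes _) _       _  = refl
does-∨ʳ (no _)  (yes _) _  = refl
does-∨ʳ (no _)  (no ¬q) q′ = ⊥-elim (¬q q′)

does-true : ∀ {P : Set} (p : Dec P) → does p ≡ true → P
does-true (yes p) _ = p

2*-mono-< : ∀ {m n} → m < n → suc (2 * m) < 2 * n
2*-mono-< {m} {n} m<n = subst (_≤ 2 * n) (*-suc 2 m) (*-monoʳ-≤ 2 m<n)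

-- Children are handed out in order: A_0, A_1, … go to B_0 in a block of size
-- Bc_0, then to B_1 in a block of size Bc_1, and so on; B_1, B_2, … go to A_0 in
-- a block of size Ac_0, then to A_1, and so on.
module BlockTree {a b : ℕ} (Ac : Vec ℕ a) (Bc : Vec ℕ (suc b))
  (Ac-nonIncreasing : NonIncreasing Ac) (Bc-nonIncreasing : NonIncreasing Bc)
  (sum-Ac : sum Ac ≡ b) (sum-Bc : sum Bc ≡ a) where

  _↑_ : V a (suc b) → V a (suc b) → Set
  inj₁ i       ↑ inj₂ j = block Bc (toℕ i) ≡ toℕ j
  inj₂ (suc j) ↑ inj₁ i = block Ac (toℕ j) ≡ toℕ i
  _            ↑ _      = ⊥

  _↑?_ : ∀ u v → Dec (u ↑ v)
  inj₁ i       ↑? inj₁ _ = no λ ()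
  inj₁ i       ↑? inj₂ j = block Bc (toℕ i) ≟ toℕ j
  inj₂ zero    ↑? _      = no λ ()
  inj₂ (suc j) ↑? inj₁ i = block Ac (toℕ j) ≟ toℕ i
  inj₂ (suc j) ↑? inj₂ _ = no λ ()

  E : EdgeSet a (suc b)
  E i j = does (inj₁ i ↑? inj₂ j) ∨ does (inj₂ j ↑? inj₁ i)

  Adj⇒↑ : ∀ {u v} → Adj E u v → u ↑ v ⊎ v ↑ u
  Adj⇒↑ {inj₁ i} {inj₂ j} e = does-∨ (inj₁ i ↑? inj₂ j) (inj₂ j ↑? inj₁ i) e
  Adj⇒↑ {inj₂ j} {inj₁ i} e = swap (does-∨ (inj₁ i ↑? inj₂ j) (inj₂ j ↑? inj₁ i) e)

  ↑⇒Adj : ∀ {u v} → u ↑ v → Adj E u v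
  ↑⇒Adj {inj₁ i}       {inj₂ j} u↑v = does-∨ˡ (inj₁ i ↑? inj₂ j) (inj₂ j ↑? inj₁ i) u↑v
  ↑⇒Adj {inj₂ (suc j)} {inj₁ i} u↑v = does-∨ʳ (inj₁ i ↑? inj₂ (suc j)) (inj₂ (suc j) ↑? inj₁ i) u↑v

  ↑-functional : ∀ {u v w} → u ↑ v → u ↑ w → v ≡ w
  ↑-functional {inj₁ i}       {inj₂ _} {inj₂ _} u↑v u↑w = cong inj₂ (toℕ-injective (trans (sym u↑v) u↑w))
  ↑-functional {inj₂ (suc j)} {inj₁ _} {inj₁ _} u↑v u↑w = cong inj₁ (toℕ-injective (trans (sym u↑v) u↑w))

  enough-B-children : ∀ k → k ≤ b → k ≤ prefixSum Ac (prefixSum Bc k)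
  enough-B-children k k≤b with k ≤? a
  ... | yes k≤a = ≤-prefixSum Ac (prefixSum Bc k) k Ac-nonIncreasing
                    (≤-prefixSum Bc k k Bc-nonIncreasing ≤-refl (subst (k ≤_) (sym sum-Bc) k≤a))
                    (subst (k ≤_) (sym sum-Ac) k≤b)
  ... | no  k≰a = subst (k ≤_) (sym (trans (prefixSum-all Ac _ a≤prefix) sum-Ac)) k≤b
    where
    a≤prefix : a ≤ prefixSum Bc k
    a≤prefix = ≤-prefixSum Bc k a Bc-nonIncreasing (<⇒≤ (≰⇒> k≰a)) (≤-reflexive (sym sum-Bc))

  -- That is, the parent of B_(p+1) hangs below one of B_0, …, B_p.
  parent-of-B-earlier : ∀ p → p < b → block Ac p < prefixSum Bc (suc p)
  parent-of-B-earlier p p<b = block<-prefixSum Ac p _ (enough-B-children (suc p) p<b)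

  parent-of-A< : ∀ (i : Fin a) → block Bc (toℕ i) < suc b
  parent-of-A< i = block<length Bc (toℕ i) (subst (toℕ i <_) (sym sum-Bc) (toℕ<n i))

  parent-of-B< : ∀ (j : Fin b) → block Ac (toℕ j) < a
  parent-of-B< j = block<length Ac (toℕ j) (subst (toℕ j <_) (sym sum-Ac) (toℕ<n j))

  -- B_j is ranked just below its first child A_(prefixSum Bc j).
  rank : V a (suc b) → ℕ
  rank (inj₁ i) = suc (2 * toℕ i)
  rank (inj₂ j) = 2 * prefixSum Bc (toℕ j)

  rank-↑ : ∀ {u v} → u ↑ v → rank v < rank u
  rank-↑ {inj₁ i} {inj₂ j} i↑j =
    s≤s (*-monoʳ-≤ 2 (subst (λ k → prefixSum Bc k ≤ toℕ i) i↑j (prefixSum-block≤ Bc (toℕ i))))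
  rank-↑ {inj₂ (suc j)} {inj₁ i} j↑i =
    2*-mono-< (subst (_< prefixSum Bc (suc (toℕ j))) j↑i (parent-of-B-earlier (toℕ j) (toℕ<n j)))

  root : V a (suc b)
  root = inj₂ zero

  has-parent : ∀ u → u ≡ root ⊎ ∃[ w ] u ↑ w
  has-parent (inj₁ i)       = inj₂ (inj₂ (fromℕ< (parent-of-A< i)) , sym (toℕ-fromℕ< (parent-of-A< i)))
  has-parent (inj₂ zero)    = inj₁ refl
  has-parent (inj₂ (suc j)) = inj₂ (inj₁ (fromℕ< (parent-of-B< j)) , sym (toℕ-fromℕ< (parent-of-B< j)))

  open RankedParents (Adj E) _↑_ rank rank-↑ ↑-functional ↑⇒Adj Adj⇒↑

  isTree : IsTree E
  isTree = rooted⇒connected root (reachesRoot root has-parent)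
         , λ (v , rest , 2≤ , uniq , walk) → noCycle v rest 2≤ uniq walk

  private
    not-both : ∀ i j → does (inj₁ i ↑? inj₂ j) ≡ true → does (inj₂ j ↑? inj₁ i) ≡ true → ⊥
    not-both i j i↑j j↑i = ↑-asym (does-true (inj₁ i ↑? inj₂ j) i↑j) (does-true (inj₂ j ↑? inj₁ i) j↑i)

  deg₁-E : ∀ i → deg₁ E i ≡ suc (lookup Ac i)
  deg₁-E i = begin
    deg₁ E i                                                ≡⟨ count-∨ _ _ (not-both i) ⟩
    countBelow (suc b) (λ q → does (block Bc (toℕ i) ≟ q))
      + countBelow b (λ p → does (block Ac p ≟ toℕ i))      ≡⟨ cong₂ _+_ (countBelow-≟ (parent-of-A< i)) children ⟩
    suc (lookup Ac i)                                       ∎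
    where
    open ≡-Reasoning
    children = subst (λ n → countBelow n (λ p → does (block Ac p ≟ toℕ i)) ≡ lookup Ac i) sum-Ac
                     (countBelow-block Ac i)

  private
    children-of-B : ∀ j → countBelow a (λ q → does (block Bc q ≟ toℕ j)) ≡ lookup Bc j
    children-of-B j = subst (λ n → countBelow n (λ q → does (block Bc q ≟ toℕ j)) ≡ lookup Bc j) sum-Bc
                            (countBelow-block Bc j)

  deg₂-E-root : deg₂ E zero ≡ lookup Bc zero
  deg₂-E-root = begin
    deg₂ E zero                               ≡⟨ count-∨ _ _ (λ i → not-both i zero) ⟩
    countBelow a (λ q → does (block Bc q ≟ 0))
      + count {a} (λ _ → false)               ≡⟨ cong₂ _+_ (children-of-B zero) (count-false a) ⟩
    lookup Bc zero + 0                        ≡⟨ +-identityʳ _ ⟩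
    lookup Bc zero                            ∎
    where open ≡-Reasoning

  deg₂-E-suc : ∀ j → deg₂ E (suc j) ≡ lookup Bc (suc j) + 1
  deg₂-E-suc j = begin
    deg₂ E (suc j)                                        ≡⟨ count-∨ _ _ (λ i → not-both i (suc j)) ⟩
    countBelow a (λ q → does (block Bc q ≟ suc (toℕ j)))
      + countBelow a (λ q → does (block Ac (toℕ j) ≟ q))  ≡⟨ cong₂ _+_ (children-of-B (suc j))
                                                                       (countBelow-≟ (parent-of-B< j)) ⟩
    lookup Bc (suc j) + 1                                 ∎
    where open ≡-Reasoning

sum-map-pred : ∀ {k} (v : Vec ℕ k) → VAll.All (_≥ 1) v → sum (map pred v) + k ≡ sum v
sum-map-pred []       []         = refl
sum-map-pred {suc k} (x ∷ v) (x≥1 ∷ v≥1) = begin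
  pred x + sum (map pred v) + suc k     ≡⟨ +-suc _ k ⟩
  suc (pred x + sum (map pred v) + k)   ≡⟨ cong suc (+-assoc (pred x) _ k) ⟩
  suc (pred x) + (sum (map pred v) + k) ≡⟨ cong₂ _+_ (suc-pred x ⦃ >-nonZero x≥1 ⦄) (sum-map-pred v v≥1) ⟩
  x + sum v                             ∎
  where open ≡-Reasoning

nonIncreasing-∷-map-pred : ∀ {k x} {xs : Vec ℕ k} → NonIncreasing (x ∷ xs) → NonIncreasing (x ∷ map pred xs)
nonIncreasing-∷-map-pred ni-[x]        = ni-[x]
nonIncreasing-∷-map-pred (ni-∷ y≤x ni) = ni-∷ (≤-trans pred[n]≤n y≤x) (nonIncreasing-map pred-mono-≤ ni)

-- A_i gets d₁ i − 1 children and B_j gets d₂ j − 1, except for the root B_0,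
-- which gets d₂ 0.
partition-tree : ∀ {a b} {d₁ : Vec ℕ a} {d₂ : Vec ℕ (suc b)} →
                 IsPartition a (a + b) d₁ → IsPartition (suc b) (a + b) d₂ →
                 Σ[ E ∈ EdgeSet a (suc b) ] IsTree E × HasDegrees E d₁ d₂
partition-tree {a} {b} {d₁} {x ∷ xs} (d₁≥1 , d₁-ni , sum-d₁) (x≥1 ∷ xs≥1 , d₂-ni , sum-d₂) =
  E , isTree , record { deg₁-≡ = deg₁-d₁ ; deg₂-≡ = deg₂-d₂ }
  where
  sum-Ac : sum (map pred d₁) ≡ b
  sum-Ac = +-cancelʳ-≡ a _ _ (trans (sum-map-pred d₁ d₁≥1) (trans sum-d₁ (+-comm a b)))
  sum-Bc : x + sum (map pred xs) ≡ a
  sum-Bc = +-cancelʳ-≡ b _ _ (trans (+-assoc x _ b) (trans (cong (x +_) (sum-map-pred xs xs≥1)) sum-d₂))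
  open BlockTree (map pred d₁) (x ∷ map pred xs) (nonIncreasing-map pred-mono-≤ d₁-ni)
                 (nonIncreasing-∷-map-pred d₂-ni) sum-Ac sum-Bc
  deg₁-d₁ : ∀ i → deg₁ E i ≡ lookup d₁ i
  deg₁-d₁ i = trans (deg₁-E i)
    (trans (cong suc (lookup-map i pred d₁)) (suc-pred _ ⦃ >-nonZero (lookup⁺ d₁≥1 i) ⦄))
  deg₂-d₂ : ∀ j → deg₂ E j ≡ lookup (x ∷ xs) j
  deg₂-d₂ zero    = deg₂-E-root
  deg₂-d₂ (suc j) = trans (deg₂-E-suc j)
    (trans (+-comm _ 1) (trans (cong suc (lookup-map j pred xs)) (suc-pred _ ⦃ >-nonZero (lookup⁺ xs≥1 j) ⦄)))

isomorphic⇒same-degrees : ∀ {a b} {E F : EdgeSet a (suc b)} {d₁ d₁′ : Vec ℕ a} {d₂ d₂′ : Vec ℕ (suc b)} →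
  a < suc b → Connected E → Isomorphic E F → HasDegrees E d₁ d₂ → HasDegrees F d₁′ d₂′ →
  NonIncreasing d₁ → NonIncreasing d₁′ → NonIncreasing d₂ → NonIncreasing d₂′ → d₁ ≡ d₁′ × d₂ ≡ d₂′
isomorphic⇒same-degrees {E = E} {F} {d₁} {d₁′} {d₂} {d₂′} a<b connected iso E-deg F-deg ni₁ ni₁′ ni₂ ni₂′ =
    atLeast-injective d₁ d₁′ ni₁ ni₁′ (λ t → begin
      atLeast (lookup d₁) t   ≡⟨ atLeast-cong (sym ∘ E-deg.deg₁-≡) t ⟩
      atLeast (deg₁ E) t      ≡⟨ atLeast-deg₁ a<b connected iso t ⟨
      atLeast (deg₁ F) t      ≡⟨ atLeast-cong F-deg.deg₁-≡ t ⟩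
      atLeast (lookup d₁′) t  ∎)
  , atLeast-injective d₂ d₂′ ni₂ ni₂′ (λ t → begin
      atLeast (lookup d₂) t   ≡⟨ atLeast-cong (sym ∘ E-deg.deg₂-≡) t ⟩
      atLeast (deg₂ E) t      ≡⟨ atLeast-deg₂ a<b connected iso t ⟨
      atLeast (deg₂ F) t      ≡⟨ atLeast-cong F-deg.deg₂-≡ t ⟩
      atLeast (lookup d₂′) t  ∎)
  where
  open ≡-Reasoning
  module E-deg = HasDegrees E-deg
  module F-deg = HasDegrees F-deg

partition-tree-injective : ∀ {a b} {d₁ d₁′ : Vec ℕ a} {d₂ d₂′ : Vec ℕ (suc b)} → a < suc b →
  (p₁ : IsPartition a (a + b) d₁) (p₂ : IsPartition (suc b) (a + b) d₂)
  (q₁ : IsPartition a (a + b) d₁′) (q₂ : IsPartition (suc b) (a + b) d₂′) →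
  Isomorphic (proj₁ (partition-tree p₁ p₂)) (proj₁ (partition-tree q₁ q₂)) → d₁ ≡ d₁′ × d₂ ≡ d₂′
partition-tree-injective a<b p₁ p₂ q₁ q₂ iso =
  isomorphic⇒same-degrees a<b (proj₁ (proj₁ (proj₂ (partition-tree p₁ p₂)))) iso
    (proj₂ (proj₂ (partition-tree p₁ p₂))) (proj₂ (proj₂ (partition-tree q₁ q₂)))
    (proj₁ (proj₂ p₁)) (proj₁ (proj₂ q₁)) (proj₁ (proj₂ p₂)) (proj₁ (proj₂ q₂))

concatMap-map≡cartesianProductWith : ∀ {A B C : Set} (f : A → B → C) xs ys →
                concatMap (λ x → List.map (f x) ys) xs ≡ cartesianProductWith f xs ys
concatMap-map≡cartesianProductWith f []       ys = refl
concatMap-map≡cartesianProductWith f (x ∷ xs) ys =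
  cong (List.map (f x) ys List.++_) (concatMap-map≡cartesianProductWith f xs ys)

vecsUpTo-unique : ∀ k m → Unique (vecsUpTo k m)
vecsUpTo-unique zero    m = [] ∷ []
vecsUpTo-unique (suc k) m =
  subst Unique (sym (concatMap-map≡cartesianProductWith _∷_ (upTo (suc m)) (vecsUpTo k m)))
    (Unique.cartesianProductWith⁺ _∷_ ∷-injective (Unique.upTo⁺ (suc m)) (vecsUpTo-unique k m))

lookup-injective : ∀ {A : Set} {xs : List A} → Unique xs → ∀ i j → List.lookup xs i ≡ List.lookup xs j → i ≡ j
lookup-injective (_     ∷ _)    zero    zero    _  = refl
lookup-injective (x∉xs ∷ _)     zero    (suc j) eq = ⊥-elim (All.lookup x∉xs (∈-lookup j) eq)
lookup-injective (x∉xs ∷ _)     (suc i) zero    eq = ⊥-elim (All.lookup x∉xs (∈-lookup i) (sym eq))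
lookup-injective (_     ∷ uniq) (suc i) (suc j) eq = cong suc (lookup-injective uniq i j eq)

partitions : ∀ k m → List (Vec ℕ k)
partitions k m = filter (isPartition? k m) (vecsUpTo k m)

partition : ∀ k m → Fin (P k m) → Vec ℕ k
partition k m = List.lookup (partitions k m)

partition-isPartition : ∀ k m i → IsPartition k m (partition k m i)
partition-isPartition k m i = All.lookup (all-filter (isPartition? k m) (vecsUpTo k m)) (∈-lookup i)

partition-injective : ∀ k m i j → partition k m i ≡ partition k m j → i ≡ j
partition-injective k m = lookup-injective (Unique.filter⁺ (isPartition? k m) (vecsUpTo-unique k m))

remQuot-injective : ∀ {m} n (i j : Fin (m * n)) → remQuot {m} n i ≡ remQuot n j → i ≡ j
remQuot-injective {m} n i j eq = begin
  i                                 ≡⟨ combine-remQuot {m} n i ⟨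
  uncurry combine (remQuot {m} n i) ≡⟨ cong (uncurry combine) eq ⟩
  uncurry combine (remQuot {m} n j) ≡⟨ combine-remQuot {m} n j ⟩
  j                                 ∎
  where open ≡-Reasoning

spanningTrees : ∀ a b → a < suc b →
  Σ (Fin (P a (a + b) * P (suc b) (a + b)) → SpanningTree a (suc b)) λ T →
    ∀ i j → Isomorphic (proj₁ (T i)) (proj₁ (T j)) → i ≡ j
spanningTrees a b a<b = T , T-injective
  where
  m  = a + b
  n₁ = P a m
  n₂ = P (suc b) m
  index₁ : Fin (n₁ * n₂) → Fin n₁
  index₁ k = proj₁ (remQuot n₂ k)
  index₂ : Fin (n₁ * n₂) → Fin n₂
  index₂ k = proj₂ (remQuot {n₁} n₂ k)
  p₁ : ∀ k → IsPartition a m (partition a m (index₁ k))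
  p₁ k = partition-isPartition a m (index₁ k)
  p₂ : ∀ k → IsPartition (suc b) m (partition (suc b) m (index₂ k))
  p₂ k = partition-isPartition (suc b) m (index₂ k)
  T : Fin (n₁ * n₂) → SpanningTree a (suc b)
  T k = proj₁ (partition-tree (p₁ k) (p₂ k)) , proj₁ (proj₂ (partition-tree (p₁ k) (p₂ k)))
  T-injective : ∀ i j → Isomorphic (proj₁ (T i)) (proj₁ (T j)) → i ≡ j
  T-injective i j iso = remQuot-injective {n₁} n₂ i j
    (×-≡,≡→≡ {p₁ = remQuot {n₁} n₂ i} {p₂ = remQuot {n₁} n₂ j}
      ( partition-injective a m (index₁ i) (index₁ j) (proj₁ same)
      , partition-injective (suc b) m (index₂ i) (index₂ j) (proj₂ same)))
    where same = partition-tree-injective a<b (p₁ i) (p₂ i) (p₁ j) (p₂ j) iso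

theorem2p3 : (a b : ℕ) → 2 ≤ a → a < b →
    Σ (Fin (P a (a + b ∸ 1) * P b (a + b ∸ 1)) → SpanningTree a b) λ T →
      (i j : Fin (P a (a + b ∸ 1) * P b (a + b ∸ 1))) →
        Isomorphic (proj₁ (T i)) (proj₁ (T j)) → i ≡ j
theorem2p3 a zero    _ ()
theorem2p3 a (suc b) _ a<b rewrite +-suc a b = spanningTrees a b a<b
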